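{- Consider the tree $T$ and active set obtained (under the reference semantics) after any valid sequence of tree-buffer operations. Then $|H_i|\ge|H_{i+1}|$ for all integers $i\ge 0$. Consequently, for every integer $h\ge 1$, $|H_{<2h}|\le 2|H_{<h}|$.
   Context: A valid sequence of tree-buffer operations is $\mathrm{initialize}(x_0)$ followed by modifying operations $\mathrm{add\_child}(x,y)$ or $\mathrm{deactivate}(x)$, with the following semantics on a rooted tree $T$ and a set $\mathrm{Active}\subseteq T$: $\mathrm{initialize}(x_0)$ creates the tree with single node $x_0$ (the root), Active $=\{x_0\}$; $\mathrm{add\_child}(x,y)$ requires $x\in$ Active and $y$ a fresh node, and adds $y$ to $T$ as a child of $x$ and to Active; $\mathrm{deactivate}(x)$ removes $x$ from Active (nodes are never removed from $T$). The subtree of $x$ is $x$ together with its descendants. The height of $x\in T$ is the minimum distance from $x$ to an active node in its subtree ($\infty$ if none). $H_i$ is the set of nodes of height $i$ and $H_{<i}$ the set of nodes of height $<i$. -}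

module Defs where

open import Data.Nat using (ℕ; zero; suc; _≡ᵇ_)
open import Data.Bool using (Bool; true; false; _∧_; not)
open import Data.List using (List; []; _∷_; foldl; filterᵇ; length; upTo)
open import Data.Bool.ListAction using (any)
open import Data.Maybe using (Maybe; just; nothing)
open import Data.Product using (_×_; _,_; proj₁; proj₂)
open import Data.Unit using (⊤)
open import Data.List.Membership.Propositional using (_∈_; _∉_)

-- Nodes are labelled by natural numbers.
-- A state records the nodes of T, the parent of every non-root node
-- (as a list of (child , parent) pairs) and the Active set.
record State : Set where
  constructor mkState
  field
    nodes   : List ℕ
    parents : List (ℕ × ℕ)
    active  : List ℕ
open State public

data Op : Set where
  add-child  : ℕ → ℕ → Op
  deactivate : ℕ → Op

initialize : ℕ → State
initialize x₀ = mkState (x₀ ∷ []) [] (x₀ ∷ [])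

remove : ℕ → List ℕ → List ℕ
remove x = filterᵇ (λ z → not (z ≡ᵇ x))

apply : State → Op → State
apply S (add-child x y) = mkState (y ∷ nodes S) ((y , x) ∷ parents S) (y ∷ active S)
apply S (deactivate x)  = mkState (nodes S) (parents S) (remove x (active S))

Enabled : State → Op → Set
Enabled S (add-child x y) = (x ∈ active S) × (y ∉ nodes S)
Enabled S (deactivate x)  = ⊤

ValidFrom : State → List Op → Set
ValidFrom S []         = ⊤
ValidFrom S (op ∷ ops) = Enabled S op × ValidFrom (apply S op) ops

run : ℕ → List Op → State
run x₀ ops = foldl apply (initialize x₀) ops

parentOf : State → ℕ → Maybe ℕ
parentOf S y = go (parents S)
  where
  go : List (ℕ × ℕ) → Maybe ℕ
  go []             = nothing
  go ((c , p) ∷ ps) with c ≡ᵇ y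
  ... | true  = just p
  ... | false = go ps

ancestor : State → ℕ → ℕ → Maybe ℕ
ancestor S zero    y = just y
ancestor S (suc k) y with ancestor S k y
... | nothing = nothing
... | just z  = parentOf S z

isJust≡ : Maybe ℕ → ℕ → Bool
isJust≡ nothing  x = false
isJust≡ (just z) x = z ≡ᵇ x

-- some active node lies in the subtree of x at distance exactly d from x
activeAt : State → ℕ → ℕ → Bool
activeAt S x d = any (λ y → isJust≡ (ancestor S d y) x) (active S)

-- height of x equals i: the minimum distance from x to an active node
-- in its subtree is i (nodes with no such active node have height ∞
-- and satisfy this for no i)
hasHeight : State → ℕ → ℕ → Bool
hasHeight S x i = activeAt S x i ∧ not (any (activeAt S x) (upTo i))

cardH : State → ℕ → ℕ
cardH S i = length (filterᵇ (λ x → hasHeight S x i) (nodes S))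

cardH< : State → ℕ → ℕ
cardH< S i = length (filterᵇ (λ x → any (hasHeight S x) (upTo i)) (nodes S))

-- The height of a node of height i+1 is attained through one of its children, which then has
-- height i; so every node of H_{i+1} is the parent of a node of H_i, and parent is a function,
-- whence |H_{i+1}| ≤ |H_i|. Since |H_{<h}| is the h-th partial sum of the antitone sequence
-- |H_i|, the sum over the block [h, 2h) is at most the sum over [0, h).
module Submission where

open import Defs
open import Data.Bool using (Bool; true; false; T; not; _∨_)
open import Data.Bool.ListAction using (any)
open import Data.Bool.Properties using (T-∧; ∨-assoc; ∨-identityʳ)
open import Data.List using (List; []; _∷_; [_]; _++_; length; filter; filterᵇ; map; foldl; upTo)
open import Data.List.Properties using (filter-notAll; filter-none; filter-≐; length-map; upTo-∷ʳ)
open import Data.List.Membership.Propositional using (_∈_; find; lose)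
open import Data.List.Membership.Propositional.Properties using (∈-filter⁺; ∈-filter⁻; ∈-map⁺; ∈-upTo⁺; ∈-upTo⁻)
open import Data.List.Relation.Binary.Subset.Propositional using (_⊆_)
open import Data.List.Relation.Unary.All as All using ()
open import Data.List.Relation.Unary.Any as Any using (here; there)
open import Data.List.Relation.Unary.Any.Properties using (any⁺; any⁻)
open import Data.List.Relation.Unary.Unique.Propositional using (Unique; []; _∷_)
open import Data.List.Relation.Unary.Unique.Propositional.Properties using (filter⁺)
open import Data.Maybe using (just; fromMaybe)
open import Data.Nat using (ℕ; zero; suc; _+_; _*_; _≤_; _<_; _≡ᵇ_; z≤n; s≤s)
open import Data.Nat.Properties using (_≟_; ≡ᵇ⇒≡; ≡⇒≡ᵇ; ≤-refl; ≤-trans; +-suc; +-assoc; +-identityʳ; +-mono-≤; module ≤-Reasoning)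
open import Data.Product using (∃; _×_; _,_; proj₁; proj₂)
open import Data.Unit using (tt)
open import Function using (_∘_; _⇔_; mk⇔; Equivalence)
open import Relation.Binary using (DecidableEquality)
open import Relation.Binary.PropositionalEquality using (_≡_; _≢_; refl; sym; trans; cong; subst; module ≡-Reasoning)
open import Relation.Nullary using (¬_; ¬?; Dec; contradiction)
open import Relation.Nullary.Decidable using (T?)
open import Relation.Unary using (_≐_)

open Equivalence using (to; from)

T-not : ∀ {b} → T (not b) ⇔ (¬ T b)
T-not {true}  = mk⇔ (λ ()) (λ ¬t → ¬t tt)
T-not {false} = mk⇔ (λ _ ()) (λ _ → tt)

T-not-any-upTo : ∀ (p : ℕ → Bool) {n} → T (not (any p (upTo n))) ⇔ (∀ {j} → j < n → ¬ T (p j))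
T-not-any-upTo p = mk⇔
  (λ t {_} j<n pj → to T-not t (any⁺ p (lose (∈-upTo⁺ j<n) pj)))
  (λ below → from T-not λ t → let _ , j∈ , pj = find (any⁻ p _ t) in below (∈-upTo⁻ j∈) pj)

any-++ : ∀ {A : Set} (p : A → Bool) xs ys → any p (xs ++ ys) ≡ any p xs ∨ any p ys
any-++ p []       ys = refl
any-++ p (x ∷ xs) ys = trans (cong (p x ∨_) (any-++ p xs ys)) (sym (∨-assoc (p x) _ _))

any-upTo-suc : ∀ (p : ℕ → Bool) n → any p (upTo (suc n)) ≡ any p (upTo n) ∨ p n
any-upTo-suc p n = begin
  any p (upTo (suc n))           ≡⟨ cong (any p) (sym (upTo-∷ʳ n)) ⟩
  any p (upTo n ++ [ n ])        ≡⟨ any-++ p (upTo n) [ n ] ⟩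
  any p (upTo n) ∨ (p n ∨ false) ≡⟨ cong (any p (upTo n) ∨_) (∨-identityʳ (p n)) ⟩
  any p (upTo n) ∨ p n           ∎
  where open ≡-Reasoning

length-filterᵇ-∨ : ∀ {A : Set} (p q : A → Bool) xs → (∀ x → T (p x) → ¬ T (q x)) →
  length (filterᵇ (λ x → p x ∨ q x) xs) ≡ length (filterᵇ p xs) + length (filterᵇ q xs)
length-filterᵇ-∨ p q []       disjoint = refl
length-filterᵇ-∨ p q (x ∷ xs) disjoint with ih ← length-filterᵇ-∨ p q xs disjoint | p x in px | q x in qx
... | true  | true  = contradiction (subst T (sym qx) tt) (disjoint x (subst T (sym px) tt))
... | true  | false = cong suc ih
... | false | true  = trans (cong suc ih) (sym (+-suc _ _))
... | false | false = ih

length-filterᵇ-false : ∀ {A : Set} (xs : List A) → length (filterᵇ (λ _ → false) xs) ≡ 0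
length-filterᵇ-false xs = cong length (filter-none (λ _ → T? false) (All.universal (λ _ ()) xs))

unique-⊆⇒length≤ : ∀ {A : Set} → DecidableEquality A → ∀ {xs ys : List A} →
  Unique xs → xs ⊆ ys → length xs ≤ length ys
unique-⊆⇒length≤ _≟_ [] _ = z≤n
unique-⊆⇒length≤ _≟_ {x ∷ xs} {ys} (x∉xs ∷ uniq) x∷xs⊆ys = begin-strict
  length xs              ≤⟨ unique-⊆⇒length≤ _≟_ uniq xs⊆ys-x ⟩
  length (filter ≢x? ys) <⟨ filter-notAll ≢x? ys (Any.map (λ x≡z z≢x → z≢x (sym x≡z)) (x∷xs⊆ys (here refl))) ⟩
  length ys              ∎
  where
  open ≤-Reasoning
  ≢x? : ∀ z → Dec (z ≢ x)
  ≢x? z = ¬? (z ≟ x)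
  xs⊆ys-x : xs ⊆ filter ≢x? ys
  xs⊆ys-x z∈xs = ∈-filter⁺ ≢x? (x∷xs⊆ys (there z∈xs)) (λ z≡x → All.lookup x∉xs z∈xs (sym z≡x))

partialSum : (ℕ → ℕ) → ℕ → ℕ
partialSum f zero    = 0
partialSum f (suc n) = partialSum f n + f n

module _ (f : ℕ → ℕ) (f-antitone : ∀ i → f (suc i) ≤ f i) where

  antitone-+ : ∀ m n → f (m + n) ≤ f n
  antitone-+ zero    n = ≤-refl
  antitone-+ (suc m) n = ≤-trans (f-antitone (m + n)) (antitone-+ m n)

  partialSum-+-≤ : ∀ m n → partialSum f (m + n) ≤ partialSum f m + partialSum f n
  partialSum-+-≤ m zero rewrite +-identityʳ m | +-identityʳ (partialSum f m) = ≤-refl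
  partialSum-+-≤ m (suc n) = begin
    partialSum f (m + suc n)                       ≡⟨ cong (partialSum f) (+-suc m n) ⟩
    partialSum f (m + n) + f (m + n)               ≤⟨ +-mono-≤ (partialSum-+-≤ m n) (antitone-+ m n) ⟩
    partialSum f m + partialSum f n + f n          ≡⟨ +-assoc (partialSum f m) _ _ ⟩
    partialSum f m + partialSum f (suc n)          ∎
    where open ≤-Reasoning

  partialSum-double : ∀ n → partialSum f (2 * n) ≤ 2 * partialSum f n
  partialSum-double n = begin
    partialSum f (n + (n + 0))                ≡⟨ cong (λ k → partialSum f (n + k)) (+-identityʳ n) ⟩
    partialSum f (n + n)                      ≤⟨ partialSum-+-≤ n n ⟩
    partialSum f n + partialSum f n           ≡⟨ cong (partialSum f n +_) (sym (+-identityʳ _)) ⟩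
    2 * partialSum f n                        ∎
    where open ≤-Reasoning

isJust≡⇒ : ∀ m x → T (isJust≡ m x) → m ≡ just x
isJust≡⇒ (just z) x t = cong just (≡ᵇ⇒≡ z x t)

isJust≡-just : ∀ x → T (isJust≡ (just x) x)
isJust≡-just x = ≡⇒≡ᵇ x x refl

module _ (S : State) where

  ancestor-suc : ∀ {k y c} → ancestor S k y ≡ just c → ancestor S (suc k) y ≡ parentOf S c
  ancestor-suc {k} {y} eq with ancestor S k y
  ancestor-suc refl | just c = refl

  ancestor-suc⁻ : ∀ {k y x} → ancestor S (suc k) y ≡ just x →
    ∃ λ c → ancestor S k y ≡ just c × parentOf S c ≡ just x
  ancestor-suc⁻ {k} {y} eq with ancestor S k y
  ... | just c = c , refl , eq

  activeAt⁺ : ∀ {x} d {y} → y ∈ active S → ancestor S d y ≡ just x → T (activeAt S x d)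
  activeAt⁺ {x} d y∈ anc = any⁺ _ (lose y∈ (subst (λ m → T (isJust≡ m x)) (sym anc) (isJust≡-just x)))

  activeAt⁻ : ∀ x d → T (activeAt S x d) → ∃ λ y → y ∈ active S × ancestor S d y ≡ just x
  activeAt⁻ x d t with y , y∈ , anc ← find (any⁻ _ _ t) = y , y∈ , isJust≡⇒ _ _ anc

  activeAt-parent : ∀ {c x} d → parentOf S c ≡ just x → T (activeAt S c d) → T (activeAt S x (suc d))
  activeAt-parent {c} d c↦x t with y , y∈ , anc ← activeAt⁻ c d t =
    activeAt⁺ (suc d) y∈ (trans (ancestor-suc {d} anc) c↦x)

  hasHeight⇔ : ∀ x i → T (hasHeight S x i) ⇔ (T (activeAt S x i) × (∀ {j} → j < i → ¬ T (activeAt S x j)))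
  hasHeight⇔ x i = mk⇔
    (λ t → let a , b = to T-∧ t in a , λ {j} → to (T-not-any-upTo (activeAt S x)) b {j})
    (λ (a , below) → from T-∧ (a , from (T-not-any-upTo (activeAt S x)) (λ {j} → below {j})))

  hasHeight-<-disjoint : ∀ {x j i} → j < i → T (hasHeight S x j) → ¬ T (hasHeight S x i)
  hasHeight-<-disjoint {x} {j} {i} j<i hj hi =
    proj₂ (to (hasHeight⇔ x i) hi) j<i (proj₁ (to (hasHeight⇔ x j) hj))

record WellFormed (S : State) : Set where
  field
    nodes-unique : Unique (nodes S)
    active⊆nodes : active S ⊆ nodes S
    parent∈nodes : ∀ {c p} → parentOf S c ≡ just p → p ∈ nodes S
open WellFormed

wellFormed-initialize : ∀ x₀ → WellFormed (initialize x₀)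
wellFormed-initialize x₀ = record
  { nodes-unique = All.[] ∷ []
  ; active⊆nodes = λ x∈ → x∈
  ; parent∈nodes = λ ()
  }

wellFormed-apply : ∀ {S} op → WellFormed S → Enabled S op → WellFormed (apply S op)
wellFormed-apply {S} (add-child x y) wf (x∈active , y∉nodes) = record
  { nodes-unique = All.tabulate (λ z∈ y≡z → y∉nodes (subst (_∈ nodes S) (sym y≡z) z∈)) ∷ nodes-unique wf
  ; active⊆nodes = λ { (here refl) → here refl ; (there z∈) → there (active⊆nodes wf z∈) }
  ; parent∈nodes = new-parent∈nodes
  }
  where
  new-parent∈nodes : ∀ {c p} → parentOf (apply S (add-child x y)) c ≡ just p → p ∈ y ∷ nodes S
  new-parent∈nodes {c} eq with y ≡ᵇ c
  new-parent∈nodes refl | true  = there (active⊆nodes wf x∈active)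
  new-parent∈nodes eq   | false = there (parent∈nodes wf eq)
wellFormed-apply {S} (deactivate x) wf _ = record
  { nodes-unique = nodes-unique wf
  ; active⊆nodes = active⊆nodes wf ∘ proj₁ ∘ ∈-filter⁻ _
  ; parent∈nodes = parent∈nodes wf
  }

wellFormed-foldl : ∀ {S} ops → WellFormed S → ValidFrom S ops → WellFormed (foldl apply S ops)
wellFormed-foldl []         wf _            = wf
wellFormed-foldl (op ∷ ops) wf (en , valid) = wellFormed-foldl ops (wellFormed-apply op wf en) valid

module _ {S : State} (wf : WellFormed S) where

  ancestor∈nodes : ∀ k {y x} → y ∈ nodes S → ancestor S k y ≡ just x → x ∈ nodes S
  ancestor∈nodes zero    y∈ refl = y∈
  ancestor∈nodes (suc k) {y} y∈ eq with ancestor S k y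
  ... | just c = parent∈nodes wf eq

  child-of-height : ∀ {x i} → T (hasHeight S x (suc i)) →
    ∃ λ c → c ∈ nodes S × T (hasHeight S c i) × parentOf S c ≡ just x
  child-of-height {x} {i} hx
    with reach-x , below-x ← to (hasHeight⇔ S x (suc i)) hx
    with y , y∈ , anc-x ← activeAt⁻ S x (suc i) reach-x
    with c , anc-c , c↦x ← ancestor-suc⁻ S {i} anc-x
    = c , ancestor∈nodes i (active⊆nodes wf y∈) anc-c
    , from (hasHeight⇔ S c i) (activeAt⁺ S i y∈ anc-c , below-c) , c↦x
    where
    below-c : ∀ {j} → j < i → ¬ T (activeAt S c j)
    below-c {j} j<i reach-c = below-x (s≤s j<i) (activeAt-parent S j c↦x reach-c)

  cardH-suc-≤ : ∀ i → cardH S (suc i) ≤ cardH S i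
  cardH-suc-≤ i = begin
    length (H (suc i))        ≤⟨ unique-⊆⇒length≤ _≟_ (filter⁺ _ (nodes-unique wf)) H[1+i]⊆parents ⟩
    length (map parent (H i)) ≡⟨ length-map parent (H i) ⟩
    length (H i)              ∎
    where
    open ≤-Reasoning
    H : ℕ → List ℕ
    H j = filterᵇ (λ x → hasHeight S x j) (nodes S)
    parent : ℕ → ℕ
    parent c = fromMaybe 0 (parentOf S c)
    H[1+i]⊆parents : H (suc i) ⊆ map parent (H i)
    H[1+i]⊆parents x∈
      with _ , hx ← ∈-filter⁻ (λ z → T? (hasHeight S z (suc i))) {xs = nodes S} x∈
      with c , c∈ , hc , c↦x ← child-of-height {i = i} hx
      = subst (_∈ map parent (H i)) (cong (fromMaybe 0) c↦x)
              (∈-map⁺ parent (∈-filter⁺ (λ z → T? (hasHeight S z i)) c∈ hc))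

cardH<-suc : ∀ S h → cardH< S (suc h) ≡ cardH< S h + cardH S h
cardH<-suc S h = begin
  length (filterᵇ (λ x → any (hasHeight S x) (upTo (suc h))) (nodes S))
    ≡⟨ cong length (filter-≐ (T? ∘ below-suc-h) (T? ∘ below-h-or-at-h) split (nodes S)) ⟩
  length (filterᵇ below-h-or-at-h (nodes S))
    ≡⟨ length-filterᵇ-∨ below-h (λ x → hasHeight S x h) (nodes S) disjoint ⟩
  cardH< S h + cardH S h ∎
  where
  open ≡-Reasoning
  below-h below-suc-h below-h-or-at-h : ℕ → Bool
  below-h x = any (hasHeight S x) (upTo h)
  below-suc-h x = any (hasHeight S x) (upTo (suc h))
  below-h-or-at-h x = below-h x ∨ hasHeight S x h
  split : T ∘ below-suc-h ≐ T ∘ below-h-or-at-h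
  split = (λ {x} → subst T (any-upTo-suc (hasHeight S x) h))
        , (λ {x} → subst T (sym (any-upTo-suc (hasHeight S x) h)))
  disjoint : ∀ x → T (below-h x) → ¬ T (hasHeight S x h)
  disjoint x t with j , j∈ , hj ← find (any⁻ (hasHeight S x) (upTo h) t) =
    hasHeight-<-disjoint S (∈-upTo⁻ j∈) hj

cardH<≡partialSum : ∀ S h → cardH< S h ≡ partialSum (cardH S) h
cardH<≡partialSum S zero    = length-filterᵇ-false (nodes S)
cardH<≡partialSum S (suc h) = trans (cardH<-suc S h) (cong (_+ cardH S h) (cardH<≡partialSum S h))

lemma3 : (x₀ : ℕ) (ops : List Op) → ValidFrom (initialize x₀) ops →
    ((i : ℕ) → cardH (run x₀ ops) (suc i) ≤ cardH (run x₀ ops) i)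
    × ((h : ℕ) → 1 ≤ h → cardH< (run x₀ ops) (2 * h) ≤ 2 * cardH< (run x₀ ops) h)
lemma3 x₀ ops valid = antitone , λ h _ → begin
  cardH< S (2 * h)             ≡⟨ cardH<≡partialSum S (2 * h) ⟩
  partialSum (cardH S) (2 * h) ≤⟨ partialSum-double (cardH S) antitone h ⟩
  2 * partialSum (cardH S) h   ≡⟨ cong (2 *_) (cardH<≡partialSum S h) ⟨
  2 * cardH< S h               ∎
  where
  open ≤-Reasoning
  S = run x₀ ops
  antitone : ∀ i → cardH S (suc i) ≤ cardH S i
  antitone = cardH-suc-≤ (wellFormed-foldl ops (wellFormed-initialize x₀) valid)
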